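{- In Nim with three piles, every P-position other than $(0,0,0)$ has exactly one parent.
   Context: A P-position of three-pile Nim is a triple $(p_1,p_2,p_3)$ of non-negative integers with $p_1\oplus p_2\oplus p_3=0$, where $\oplus$ denotes bitwise XOR. For a position $P$, $\#(P)$ is its total number of counters. A P-position $P_1$ is a parent of a P-position $P_2$ if $\#(P_1)+2=\#(P_2)$ and $P_1$ is obtained from $P_2$ by subtracting one counter from each of two distinct piles. -}

module Defs where

open import Data.Nat using (ℕ; zero; suc; _+_; _*_)
open import Data.Nat.DivMod using (_/_; _%_)
open import Data.Bool using (Bool; true; false; _xor_)
open import Data.Product using (_×_; _,_; ∃)
open import Data.Sum using (_⊎_)
open import Relation.Binary.PropositionalEquality using (_≡_; _≢_)

bitOf : ℕ → Bool
bitOf n with n % 2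
... | zero = false
... | suc _ = true

bitToℕ : Bool → ℕ
bitToℕ false = 0
bitToℕ true  = 1

-- bitwise XOR with fuel; fuel ≥ number of binary digits suffices
xorFuel : ℕ → ℕ → ℕ → ℕ
xorFuel zero     _ _ = 0
xorFuel (suc f) a b = bitToℕ (bitOf a xor bitOf b) + 2 * xorFuel f (a / 2) (b / 2)

-- bitwise XOR on ℕ (fuel a + b exceeds the bit length of a and b)
_⊕_ : ℕ → ℕ → ℕ
a ⊕ b = xorFuel (a + b) a b

infixl 6 _⊕_

Position : Set
Position = ℕ × ℕ × ℕ

#_ : Position → ℕ
# (p₁ , p₂ , p₃) = p₁ + p₂ + p₃

IsP : Position → Set
IsP (p₁ , p₂ , p₃) = p₁ ⊕ p₂ ⊕ p₃ ≡ 0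

SubtractTwo : Position → Position → Set
SubtractTwo (q₁ , q₂ , q₃) (p₁ , p₂ , p₃) =
    (suc q₁ ≡ p₁ × suc q₂ ≡ p₂ × q₃ ≡ p₃)
  ⊎ (suc q₁ ≡ p₁ × q₂ ≡ p₂ × suc q₃ ≡ p₃)
  ⊎ (q₁ ≡ p₁ × suc q₂ ≡ p₂ × suc q₃ ≡ p₃)

IsParent : Position → Position → Set
IsParent P₁ P₂ = IsP P₁ × IsP P₂ × (# P₁ + 2 ≡ # P₂) × SubtractTwo P₁ P₂

-- Write each pile in binary, P = r + 2x with r ∈ {0,1}³ the vector of last digits. As ⊕ acts
-- digitwise, P is a P-position iff r has even weight and x is a P-position. Removing a 0/1-vector
-- u of counters from P reaches a P-position only if u has even weight, and it then amounts to
-- removing u ∧ ¬r from x. If r ≠ 0 it is a pair of piles: removing that pair works, and any other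
-- pair u would leave the single pile u ∧ ¬r to be removed from x, which has odd weight. If r = 0,
-- the pairs that work for P are exactly those that work for x, which has fewer counters.
module Submission where

open import Defs
open import Algebra.Bundles using (CommutativeRing)
open import Data.Bool using (Bool; true; false; not; _∧_; _xor_)
open import Data.Bool.Properties using (xor-∧-commutativeRing; xor-identityʳ; ∧-identityʳ)
open import Data.Nat using (ℕ; zero; suc; _+_; _*_; _≤_; _<_; z≤n; s≤s; ≢-nonZero)
open import Data.Nat.Properties
open import Data.Nat.DivMod using (_/_; _%_; %-remove-+ʳ; +-distrib-/-∣ʳ; m*n/n≡m; /-monoˡ-≤; m/n<m)
open import Data.Nat.Divisibility using (m∣m*n)
open import Data.Nat.Induction using (<-wellFounded)
open import Data.Product using (_×_; _,_; ∃; Σ; proj₁; proj₂)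
open import Data.Sum using (_⊎_; inj₁; inj₂)
open import Function using (_∘_)
open import Function.Bundles using (_⇔_; mk⇔; Equivalence)
open import Induction.WellFounded using (Acc; acc)
open import Relation.Binary.PropositionalEquality
open import Algebra.Properties.CommutativeSemigroup
  (CommutativeRing.+-commutativeSemigroup xor-∧-commutativeRing)
  using () renaming (interchange to xor-interchange)
open import Algebra.Properties.CommutativeSemigroup +-commutativeSemigroup
  using () renaming (interchange to +-interchange)

data Binary : ℕ → Set where
  digits : (r : Bool) (m : ℕ) → Binary (bitToℕ r + 2 * m)

binary : ∀ n → Binary n
binary zero = digits false 0
binary (suc n) with binary n
... | digits false m = digits true m
... | digits true  m = subst Binary (*-suc 2 m) (digits false (suc m))

digits%2 : ∀ r m → (bitToℕ r + 2 * m) % 2 ≡ bitToℕ r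
digits%2 false m = %-remove-+ʳ 0 {d = 2} (m∣m*n m)
digits%2 true  m = %-remove-+ʳ 1 {d = 2} (m∣m*n m)

digits/2 : ∀ r m → (bitToℕ r + 2 * m) / 2 ≡ m
digits/2 r m = trans (+-distrib-/-∣ʳ (bitToℕ r) {d = 2} (m∣m*n m)) (cong₂ _+_ (bit/2 r) 2m/2)
  where
  bit/2 : ∀ r → bitToℕ r / 2 ≡ 0
  bit/2 false = refl
  bit/2 true  = refl
  2m/2 : 2 * m / 2 ≡ m
  2m/2 = trans (cong (_/ 2) (*-comm 2 m)) (m*n/n≡m m 2)

bitOf-digits : ∀ r m → bitOf (bitToℕ r + 2 * m) ≡ r
bitOf-digits false m rewrite digits%2 false m = refl
bitOf-digits true  m rewrite digits%2 true m = refl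

digits-injective : ∀ {r s m n} → bitToℕ r + 2 * m ≡ bitToℕ s + 2 * n → r ≡ s × m ≡ n
digits-injective {r} {s} {m} {n} eq =
    trans (sym (bitOf-digits r m)) (trans (cong bitOf eq) (bitOf-digits s n))
  , trans (sym (digits/2 r m)) (trans (cong (_/ 2) eq) (digits/2 s n))

m≤digits : ∀ r m → m ≤ bitToℕ r + 2 * m
m≤digits r m = ≤-trans (m≤m+n m (m + 0)) (m≤n+m (2 * m) (bitToℕ r))

n≤1+f⇒n/2≤f : ∀ {n f} → n ≤ suc f → n / 2 ≤ f
n≤1+f⇒n/2≤f {n} {f} n≤1+f =
  ≤-pred (≤-<-trans (/-monoˡ-≤ 2 n≤1+f) (m/n<m (suc f) 2 (s≤s (s≤s z≤n))))

xorFuel-digits : ∀ f r m s n →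
  xorFuel (suc f) (bitToℕ r + 2 * m) (bitToℕ s + 2 * n) ≡ bitToℕ (r xor s) + 2 * xorFuel f m n
xorFuel-digits f r m s n
  rewrite bitOf-digits r m | bitOf-digits s n | digits/2 r m | digits/2 s n = refl

xorFuel-zero : ∀ f → xorFuel f 0 0 ≡ 0
xorFuel-zero zero    = refl
xorFuel-zero (suc f) = cong (2 *_) (xorFuel-zero f)

xorFuel-stable : ∀ {f g a b} → a ≤ f → b ≤ f → f ≤ g → xorFuel f a b ≡ xorFuel g a b
xorFuel-stable {zero}  {g}     z≤n z≤n _ = sym (xorFuel-zero g)
xorFuel-stable {suc f} {suc g} {a} {b} a≤ b≤ (s≤s f≤g) =
  cong (λ t → bitToℕ (bitOf a xor bitOf b) + 2 * t)
       (xorFuel-stable (n≤1+f⇒n/2≤f a≤) (n≤1+f⇒n/2≤f b≤) f≤g)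

⊕-digits : ∀ r m s n → (bitToℕ r + 2 * m) ⊕ (bitToℕ s + 2 * n) ≡ bitToℕ (r xor s) + 2 * (m ⊕ n)
⊕-digits r m s n = begin
  xorFuel (a + b) a b                         ≡⟨ xorFuel-stable (m≤m+n a b) (m≤n+m b a) (n≤1+n (a + b)) ⟩
  xorFuel (suc (a + b)) a b                   ≡⟨ xorFuel-digits (a + b) r m s n ⟩
  bitToℕ (r xor s) + 2 * xorFuel (a + b) m n  ≡⟨ cong (λ t → bitToℕ (r xor s) + 2 * t) (sym fuel-m+n) ⟩
  bitToℕ (r xor s) + 2 * (m ⊕ n)              ∎
  where
  open ≡-Reasoning
  a = bitToℕ r + 2 * m
  b = bitToℕ s + 2 * n
  fuel-m+n : xorFuel (m + n) m n ≡ xorFuel (a + b) m n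
  fuel-m+n = xorFuel-stable (m≤m+n m n) (m≤n+m n m) (+-mono-≤ (m≤digits r m) (m≤digits s n))

Bits³ : Set
Bits³ = Bool × Bool × Bool

parity : Bits³ → Bool
parity (r₁ , r₂ , r₃) = (r₁ xor r₂) xor r₃

_⊻_ : Bits³ → Bits³ → Bits³
(u₁ , u₂ , u₃) ⊻ (s₁ , s₂ , s₃) = u₁ xor s₁ , u₂ xor s₂ , u₃ xor s₃

_∖_ : Bits³ → Bits³ → Bits³
(u₁ , u₂ , u₃) ∖ (r₁ , r₂ , r₃) = u₁ ∧ not r₁ , u₂ ∧ not r₂ , u₃ ∧ not r₃

zeros : Bits³
zeros = false , false , false

bits : Bits³ → Position → Position
bits (r₁ , r₂ , r₃) (x₁ , x₂ , x₃) = bitToℕ r₁ + 2 * x₁ , bitToℕ r₂ + 2 * x₂ , bitToℕ r₃ + 2 * x₃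

data BinaryPosition : Position → Set where
  digits³ : (r : Bits³) (x : Position) → BinaryPosition (bits r x)

binaryPosition : ∀ P → BinaryPosition P
binaryPosition (a , b , c) with binary a | binary b | binary c
... | digits r₁ x₁ | digits r₂ x₂ | digits r₃ x₃ = digits³ (r₁ , r₂ , r₃) (x₁ , x₂ , x₃)

parity-⊻ : ∀ u s → parity (u ⊻ s) ≡ parity u xor parity s
parity-⊻ (u₁ , u₂ , u₃) (s₁ , s₂ , s₃) = begin
  ((u₁ xor s₁) xor (u₂ xor s₂)) xor (u₃ xor s₃) ≡⟨ cong (_xor (u₃ xor s₃)) (xor-interchange u₁ s₁ u₂ s₂) ⟩
  ((u₁ xor u₂) xor (s₁ xor s₂)) xor (u₃ xor s₃) ≡⟨ xor-interchange (u₁ xor u₂) (s₁ xor s₂) u₃ s₃ ⟩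
  ((u₁ xor u₂) xor u₃) xor ((s₁ xor s₂) xor s₃) ∎
  where open ≡-Reasoning

∖-zeros : ∀ u → u ∖ zeros ≡ u
∖-zeros (u₁ , u₂ , u₃) rewrite ∧-identityʳ u₁ | ∧-identityʳ u₂ | ∧-identityʳ u₃ = refl

IsP-bits : ∀ r x → IsP (bits r x) ⇔ (parity r ≡ false × IsP x)
IsP-bits (r₁ , r₂ , r₃) (x₁ , x₂ , x₃) =
  mk⇔ (λ isP → digits-injective {s = false} {n = 0} (trans (sym xor-digits) isP))
      (λ (even , isP) → trans xor-digits (cong₂ (λ b n → bitToℕ b + 2 * n) even isP))
  where
  xor-digits : (bitToℕ r₁ + 2 * x₁) ⊕ (bitToℕ r₂ + 2 * x₂) ⊕ (bitToℕ r₃ + 2 * x₃)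
             ≡ bitToℕ ((r₁ xor r₂) xor r₃) + 2 * (x₁ ⊕ x₂ ⊕ x₃)
  xor-digits = trans (cong (_⊕ (bitToℕ r₃ + 2 * x₃)) (⊕-digits r₁ x₁ r₂ x₂))
                     (⊕-digits (r₁ xor r₂) (x₁ ⊕ x₂) r₃ x₃)

Lowers : Bits³ → Position → Position → Set
Lowers (u₁ , u₂ , u₃) (q₁ , q₂ , q₃) (p₁ , p₂ , p₃) =
  bitToℕ u₁ + q₁ ≡ p₁ × bitToℕ u₂ + q₂ ≡ p₂ × bitToℕ u₃ + q₃ ≡ p₃

DropsToP : Bits³ → Position → Set
DropsToP u P = Σ Position λ Q → IsP Q × Lowers u Q P

-- Removing uᵢ from rᵢ + 2xᵢ borrows from xᵢ exactly when uᵢ = 1 and rᵢ = 0.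
lower-digit : ∀ u s r y x → bitToℕ u + (bitToℕ s + 2 * y) ≡ bitToℕ r + 2 * x →
              u xor s ≡ r × bitToℕ (u ∧ not r) + y ≡ x
lower-digit false false r y x eq with digits-injective {false} {r} {y} {x} eq
... | refl , refl = refl , refl
lower-digit false true r y x eq with digits-injective {true} {r} {y} {x} eq
... | refl , refl = refl , refl
lower-digit true false r y x eq with digits-injective {true} {r} {y} {x} eq
... | refl , refl = refl , refl
lower-digit true true r y x eq with digits-injective {false} {r} {suc y} {x} (trans (*-suc 2 y) eq)
... | refl , refl = refl , refl

lowers-digits : ∀ u s r y x → Lowers u (bits s y) (bits r x) → u ⊻ s ≡ r × Lowers (u ∖ r) y x
lowers-digits (u₁ , u₂ , u₃) (s₁ , s₂ , s₃) (r₁ , r₂ , r₃) (y₁ , y₂ , y₃) (x₁ , x₂ , x₃)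
              (e₁ , e₂ , e₃)
  with lower-digit u₁ s₁ r₁ y₁ x₁ e₁
     | lower-digit u₂ s₂ r₂ y₂ x₂ e₂
     | lower-digit u₃ s₃ r₃ y₃ x₃ e₃
... | refl , l₁ | refl , l₂ | refl , l₃ = refl , l₁ , l₂ , l₃

DropsToP-digits : ∀ {u r x} → DropsToP u (bits r x) → DropsToP (u ∖ r) x
DropsToP-digits {u} {r} {x} (Q , isP , low) with binaryPosition Q
... | digits³ s y =
  y , proj₂ (Equivalence.to (IsP-bits s y) isP) , proj₂ (lowers-digits u s r y x low)

DropsToP-even : ∀ {u P} → IsP P → DropsToP u P → parity u ≡ false
DropsToP-even {u} {P} isP (Q , isQ , low) with binaryPosition P | binaryPosition Q
... | digits³ r x | digits³ s y with lowers-digits u s r y x low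
... | refl , _ = begin
  parity u                   ≡⟨ sym (xor-identityʳ (parity u)) ⟩
  parity u xor false         ≡⟨ cong (parity u xor_) (sym (proj₁ (Equivalence.to (IsP-bits s y) isQ))) ⟩
  parity u xor parity s      ≡⟨ sym (parity-⊻ u s) ⟩
  parity (u ⊻ s)             ≡⟨ proj₁ (Equivalence.to (IsP-bits (u ⊻ s) x) isP) ⟩
  false                      ∎
  where open ≡-Reasoning

DropsToP-self : ∀ r x → IsP x → DropsToP r (bits r x)
DropsToP-self r x isP =
  bits zeros x , Equivalence.from (IsP-bits zeros x) (refl , isP) , refl , refl , refl

double-digit : ∀ u {y x} → bitToℕ u + y ≡ x → bitToℕ u + (bitToℕ u + 2 * y) ≡ 2 * x
double-digit false refl = refl
double-digit true {y} refl = sym (*-suc 2 y)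

DropsToP-double : ∀ {u x} → parity u ≡ false → DropsToP u x → DropsToP u (bits zeros x)
DropsToP-double {u₁ , u₂ , u₃} even (y , isP , l₁ , l₂ , l₃) =
  bits (u₁ , u₂ , u₃) y , Equivalence.from (IsP-bits (u₁ , u₂ , u₃) y) (even , isP) ,
  double-digit u₁ l₁ , double-digit u₂ l₂ , double-digit u₃ l₃

data PilePair : Set where
  p₁₂ p₁₃ p₂₃ : PilePair

mask : PilePair → Bits³
mask p₁₂ = true  , true  , false
mask p₁₃ = true  , false , true
mask p₂₃ = false , true  , true

mask-even : ∀ p → parity (mask p) ≡ false
mask-even p₁₂ = refl
mask-even p₁₃ = refl
mask-even p₂₃ = refl

even-bits : ∀ r → parity r ≡ false → r ≡ zeros ⊎ ∃ λ p → r ≡ mask p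
even-bits (false , false , false) _ = inj₁ refl
even-bits (true  , true  , false) _ = inj₂ (p₁₂ , refl)
even-bits (true  , false , true ) _ = inj₂ (p₁₃ , refl)
even-bits (false , true  , true ) _ = inj₂ (p₂₃ , refl)
even-bits (false , false , true ) ()
even-bits (false , true  , false) ()
even-bits (true  , false , false) ()
even-bits (true  , true  , true ) ()

mask-∖-even⇒≡ : ∀ p q → parity (mask p ∖ mask q) ≡ false → p ≡ q
mask-∖-even⇒≡ p₁₂ p₁₂ _ = refl
mask-∖-even⇒≡ p₁₃ p₁₃ _ = refl
mask-∖-even⇒≡ p₂₃ p₂₃ _ = refl
mask-∖-even⇒≡ p₁₂ p₁₃ ()
mask-∖-even⇒≡ p₁₂ p₂₃ ()
mask-∖-even⇒≡ p₁₃ p₁₂ ()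
mask-∖-even⇒≡ p₁₃ p₂₃ ()
mask-∖-even⇒≡ p₂₃ p₁₂ ()
mask-∖-even⇒≡ p₂₃ p₁₃ ()

UniqueParentPair : Position → Set
UniqueParentPair P = Σ PilePair λ p → DropsToP (mask p) P × (∀ q → DropsToP (mask q) P → q ≡ p)

uniqueParentPair-odd : ∀ p x → IsP x → UniqueParentPair (bits (mask p) x)
uniqueParentPair-odd p x isP = p , DropsToP-self (mask p) x isP ,
  λ q d → mask-∖-even⇒≡ q p (DropsToP-even isP (DropsToP-digits {r = mask p} {x} d))

uniqueParentPair-double : ∀ x → UniqueParentPair x → UniqueParentPair (bits zeros x)
uniqueParentPair-double x (p , d , unique) = p , DropsToP-double (mask-even p) d ,
  λ q d′ → unique q (subst (λ u → DropsToP u x) (∖-zeros (mask q))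
                                (DropsToP-digits {r = zeros} {x} d′))

#≡0⇒≡0 : ∀ P → # P ≡ 0 → P ≡ (0 , 0 , 0)
#≡0⇒≡0 (zero , zero , zero) _ = refl

#-double : ∀ x → # (bits zeros x) ≡ 2 * # x
#-double (x₁ , x₂ , x₃) =
  sym (trans (*-distribˡ-+ 2 (x₁ + x₂) x₃) (cong (_+ 2 * x₃) (*-distribˡ-+ 2 x₁ x₂)))

#-halves : ∀ x → x ≢ (0 , 0 , 0) → # x < # (bits zeros x)
#-halves x x≢0 = begin-strict
  # x                <⟨ m<m*n (# x) 2 {{≢-nonZero (x≢0 ∘ #≡0⇒≡0 x)}} (s≤s (s≤s z≤n)) ⟩
  # x * 2            ≡⟨ *-comm (# x) 2 ⟩
  2 * # x            ≡⟨ #-double x ⟨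
  # (bits zeros x)   ∎
  where open ≤-Reasoning

uniqueParentPair : ∀ P → Acc _<_ (# P) → IsP P → P ≢ (0 , 0 , 0) → UniqueParentPair P
uniqueParentPair P (acc rec) isP P≢0 with binaryPosition P
... | digits³ r x with Equivalence.to (IsP-bits r x) isP
... | even , isPx with even-bits r even
...   | inj₂ (p , refl) = uniqueParentPair-odd p x isPx
...   | inj₁ refl =
  uniqueParentPair-double x (uniqueParentPair x (rec (#-halves x x≢0)) isPx x≢0)
  where
  x≢0 : x ≢ (0 , 0 , 0)
  x≢0 refl = P≢0 refl

lowers-functional : ∀ u {Q R P} → Lowers u Q P → Lowers u R P → Q ≡ R
lowers-functional (u₁ , u₂ , u₃) (e₁ , e₂ , e₃) (f₁ , f₂ , f₃) =
  cong₂ _,_ (cancel u₁ e₁ f₁) (cong₂ _,_ (cancel u₂ e₂ f₂) (cancel u₃ e₃ f₃))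
  where
  cancel : ∀ b {q r p} → bitToℕ b + q ≡ p → bitToℕ b + r ≡ p → q ≡ r
  cancel b e f = +-cancelˡ-≡ (bitToℕ b) _ _ (trans e (sym f))

weight : Bits³ → ℕ
weight (u₁ , u₂ , u₃) = bitToℕ u₁ + bitToℕ u₂ + bitToℕ u₃

#-lowers : ∀ u {Q P} → Lowers u Q P → # P ≡ weight u + # Q
#-lowers (u₁ , u₂ , u₃) {q₁ , q₂ , q₃} (refl , refl , refl) = begin
  (a + q₁) + (b + q₂) + (c + q₃)  ≡⟨ cong (_+ (c + q₃)) (+-interchange a q₁ b q₂) ⟩
  (a + b) + (q₁ + q₂) + (c + q₃)  ≡⟨ +-interchange (a + b) (q₁ + q₂) c q₃ ⟩
  (a + b + c) + (q₁ + q₂ + q₃)    ∎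
  where
  open ≡-Reasoning
  a = bitToℕ u₁
  b = bitToℕ u₂
  c = bitToℕ u₃

weight-mask : ∀ p → weight (mask p) ≡ 2
weight-mask p₁₂ = refl
weight-mask p₁₃ = refl
weight-mask p₂₃ = refl

#-lowers-pair : ∀ p {Q P} → Lowers (mask p) Q P → # Q + 2 ≡ # P
#-lowers-pair p {Q} {P} l = begin
  # Q + 2                ≡⟨ +-comm (# Q) 2 ⟩
  2 + # Q                ≡⟨ cong (_+ # Q) (weight-mask p) ⟨
  weight (mask p) + # Q  ≡⟨ #-lowers (mask p) l ⟨
  # P                    ∎
  where open ≡-Reasoning

subtractTwo⇒lowers : ∀ {Q P} → SubtractTwo Q P → ∃ λ p → Lowers (mask p) Q P
subtractTwo⇒lowers (inj₁ l)        = p₁₂ , l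
subtractTwo⇒lowers (inj₂ (inj₁ l)) = p₁₃ , l
subtractTwo⇒lowers (inj₂ (inj₂ l)) = p₂₃ , l

lowers⇒subtractTwo : ∀ p {Q P} → Lowers (mask p) Q P → SubtractTwo Q P
lowers⇒subtractTwo p₁₂ l = inj₁ l
lowers⇒subtractTwo p₁₃ l = inj₂ (inj₁ l)
lowers⇒subtractTwo p₂₃ l = inj₂ (inj₂ l)

corollary22 : (P : Position) → IsP P → P ≢ (0 , 0 , 0) →
    ∃ λ Q → IsParent Q P × ((R : Position) → IsParent R P → R ≡ Q)
corollary22 P isP P≢0 with uniqueParentPair P (<-wellFounded (# P)) isP P≢0
... | p , (Q , isQ , lowers) , unique =
  Q , (isQ , isP , #-lowers-pair p lowers , lowers⇒subtractTwo p lowers) , onlyParent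
  where
  onlyParent : (R : Position) → IsParent R P → R ≡ Q
  onlyParent R (isR , _ , _ , subtract) with subtractTwo⇒lowers subtract
  ... | q , lowersR with unique q (R , isR , lowersR)
  ... | refl = lowers-functional (mask q) lowersR lowers
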